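{- Let $n\ge 1$. The (circular) binary strings produced by the constructions CCR2 and CCR3 of order $n$ each have discrepancy at most $2n$.
   Context: For a binary string $w$, $|w|_a$ is the number of occurrences of $a$ in $w$, $\operatorname{csub}(w)$ the set of substrings of $w$ viewed circularly, and $\operatorname{disc}(w)=\max_{u\in \operatorname{csub}(w)}\big|\,|u|_1-|u|_0\,\big|$. For a binary string $\alpha$, $\overline{\alpha}$ is its bitwise complement, and the periodic reduction $\operatorname{pr}(\alpha)$ is the shortest prefix $\beta$ of $\alpha$ such that $\alpha=\beta^j$ for some $j\ge1$. The complemented cycling register is the map on length-$n$ binary strings $a_1a_2\cdots a_n\mapsto a_2\cdots a_n(1\oplus a_1)$ ($\oplus$ is addition mod 2); its orbits partition $\{0,1\}^n$ into equivalence classes called co-necklaces. Colex order compares strings lexicographically reading from right to left. Construction CCR2: take as representative of each co-necklace class its lexicographically smallest string; list the representatives $\alpha_1,\ldots,\alpha_m$ in colex order; output $\operatorname{pr}(\alpha_1\overline{\alpha_1})\operatorname{pr}(\alpha_2\overline{\alpha_2})\cdots\operatorname{pr}(\alpha_m\overline{\alpha_m})$. Construction CCR3: take as representative of each class the string obtained from its lexicographically smallest string by removing its longest prefix of the form $0^j$ and appending $1^j$ at the end; list these representatives $\alpha_1,\ldots,\alpha_m$ in lexicographic order; output $\operatorname{pr}(\alpha_1\overline{\alpha_1})\cdots\operatorname{pr}(\alpha_m\overline{\alpha_m})$. -}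

module Defs where

open import Data.Bool using (Bool; true; false; not)
open import Data.Nat using (ℕ; zero; suc; _∸_; _⊔_; _≤_; _/_; _*_)
open import Data.List using (List; []; _∷_; _++_; [_]; length; take; drop; reverse;
  replicate; concat; concatMap; map; upTo; foldr; filter; applyUpTo)
open import Data.List.Properties using (≡-dec)
open import Data.List.Relation.Unary.Linked using (Linked)
open import Data.List.Membership.Propositional using (_∈_)
open import Data.Product using (Σ; _×_; ∃)
open import Data.Sum using (_⊎_)
open import Function using (_∘_)
open import Relation.Nullary using (does)
open import Relation.Binary.PropositionalEquality using (_≡_)
import Data.Bool as B

-- Binary strings are lists of booleans (false = 0, true = 1).
Str : Set
Str = List Bool

count : Bool → Str → ℕ
count a [] = 0
count a (x ∷ w) with does (a B.≟ x)
... | true  = suc (count a w)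
... | false = count a w

imbalance : Str → ℕ
imbalance u = (count true u ∸ count false u) ⊔ (count false u ∸ count true u)

-- circular substrings of w: all strings of length k (0 ≤ k ≤ |w|) starting
-- at a position i (0 ≤ i < |w|), read cyclically.
csub : Str → List Str
csub w = concatMap (λ i → applyUpTo (λ k → take k (drop i (w ++ w))) (suc (length w)))
                   (upTo (length w))

disc : Str → ℕ
disc w = foldr _⊔_ 0 (map imbalance (csub w))

compl : Str → Str
compl = map not

-- periodic reduction: the shortest prefix β with α = β^j
_==_ : Str → Str → Bool
x == y = does (≡-dec B._≟_ x y)

power : ℕ → Str → Str
power j β = concat (replicate j β)

firstPeriod : Str → List ℕ → Str
firstPeriod α [] = α
firstPeriod α (p ∷ ps) with p
... | zero  = firstPeriod α ps
... | suc q with power (length α / suc q) (take (suc q) α) == α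
...   | true  = take (suc q) α
...   | false = firstPeriod α ps

pr : Str → Str
pr α = firstPeriod α (applyUpTo suc (length α))

ccr : Str → Str
ccr []      = []
ccr (a ∷ w) = w ++ [ not a ]

iter : ℕ → (Str → Str) → Str → Str
iter zero    f x = x
iter (suc k) f x = f (iter k f x)

data _<lex_ : Str → Str → Set where
  halt  : ∀ {y ys} → [] <lex (y ∷ ys)
  here  : ∀ {xs ys} → (false ∷ xs) <lex (true ∷ ys)
  there : ∀ {b xs ys} → xs <lex ys → (b ∷ xs) <lex (b ∷ ys)

_≤lex_ : Str → Str → Set
x ≤lex y = x ≡ y ⊎ x <lex y

_<colex_ : Str → Str → Set
x <colex y = reverse x <lex reverse y

-- α is a co-necklace representative of order n: it has length n and it is the
-- lexicographically smallest string in its class (orbit under ccr).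
IsCoNecklaceRep : ℕ → Str → Set
IsCoNecklaceRep n α = length α ≡ n × (∀ k → α ≤lex iter k ccr α)

leadingZeros : Str → ℕ
leadingZeros []          = 0
leadingZeros (false ∷ w) = suc (leadingZeros w)
leadingZeros (true ∷ w)  = 0

shiftRep : Str → Str
shiftRep α = drop (leadingZeros α) α ++ replicate (leadingZeros α) true

construct : List Str → Str
construct = concatMap (λ α → pr (α ++ compl α))

IsCCR2List : ℕ → List Str → Set
IsCCR2List n L = Linked _<colex_ L × (∀ α → (α ∈ L → IsCoNecklaceRep n α) × (IsCoNecklaceRep n α → α ∈ L))

IsCCR3Rep : ℕ → Str → Set
IsCCR3Rep n β = ∃ λ α → IsCoNecklaceRep n α × β ≡ shiftRep α

IsCCR3List : ℕ → List Str → Set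
IsCCR3List n L = Linked _<lex_ L × (∀ β → (β ∈ L → IsCCR3Rep n β) × (IsCCR3Rep n β → β ∈ L))

module Submission where

-- Give each letter the weight +1 (for 1) or -1 (for 0), so that
-- the imbalance of u is the absolute value of its total weight.  Call a string
-- n-balanced if its total weight is 0 and every prefix has weight in [-n, n].
--
--  * For |α| = n, the block α ++ compl α is n-balanced: prefixes inside α are
--    short, and a prefix α ++ take j (compl α) has the weight of drop j α.
--  * The periodic reduction of an n-balanced string is n-balanced: it is a
--    prefix, and its weight times the number of repetitions is 0.
--  * Concatenations of n-balanced strings are n-balanced; hence so is the
--    output of the construction on any list of length-n strings, and so is
--    w ++ w.  Every circular substring of w is a factor of w ++ w, whose weight
--    is a difference of two prefix weights, hence at most 2n in absolute value.
--
-- The theorem only needs that all CCR2 and CCR3 representatives have length n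
-- (for CCR3 because shiftRep preserves length).

open import Defs
open import Data.Nat using (ℕ; _≤_; _*_)
open import Data.List using (List)
open import Data.Product using (_×_)

open import Data.Bool using (Bool; true; false; not)
open import Data.Nat as ℕ using (zero; suc; _∸_; _⊔_; _⊓_; z≤n; s≤s)
import Data.Nat.Properties as ℕP
open import Data.Integer as ℤ using (ℤ; +_; 0ℤ; 1ℤ; -1ℤ; ∣_∣; _⊖_)
  renaming (_+_ to _+ℤ_; _*_ to _*ℤ_; -_ to -ℤ_)
import Data.Integer.Properties as ℤP
open import Data.Integer.Tactic.RingSolver using (solve-∀)
open import Data.List using ([]; _∷_; _++_; take; drop; length; map; replicate; applyUpTo; foldr)
import Data.List.Properties as ListP
open import Data.List.Relation.Unary.All using (All; []; _∷_)
import Data.List.Relation.Unary.All.Properties as AllP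
open import Data.List.Membership.Propositional using (_∈_)
open import Data.List.Relation.Unary.Any using (here; there)
open import Data.Product using (_,_; proj₁; proj₂; ∃)
open import Data.Sum using (_⊎_; inj₁; inj₂)
open import Relation.Binary.PropositionalEquality
open import Relation.Nullary using (yes; no)
import Data.Bool as Bool

weight : Str → ℤ
weight []          = 0ℤ
weight (true ∷ w)  = 1ℤ +ℤ weight w
weight (false ∷ w) = -1ℤ +ℤ weight w

weight-++ : ∀ u v → weight (u ++ v) ≡ weight u +ℤ weight v
weight-++ []          v = sym (ℤP.+-identityˡ (weight v))
weight-++ (true ∷ u)  v = trans (cong (1ℤ +ℤ_) (weight-++ u v)) (sym (ℤP.+-assoc 1ℤ (weight u) (weight v)))
weight-++ (false ∷ u) v = trans (cong (-1ℤ +ℤ_) (weight-++ u v)) (sym (ℤP.+-assoc -1ℤ (weight u) (weight v)))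

weight-compl : ∀ u → weight (compl u) ≡ -ℤ weight u
weight-compl []          = refl
weight-compl (true ∷ u)  = trans (cong (-1ℤ +ℤ_) (weight-compl u)) (sym (ℤP.neg-distrib-+ 1ℤ (weight u)))
weight-compl (false ∷ u) = trans (cong (1ℤ +ℤ_) (weight-compl u)) (sym (ℤP.neg-distrib-+ -1ℤ (weight u)))

weight-power : ∀ m β → weight (power m β) ≡ + m *ℤ weight β
weight-power zero    β = refl
weight-power (suc m) β = begin
  weight (β ++ power m β)           ≡⟨ weight-++ β (power m β) ⟩
  weight β +ℤ weight (power m β)    ≡⟨ cong₂ _+ℤ_ (sym (ℤP.*-identityˡ (weight β))) (weight-power m β) ⟩
  1ℤ *ℤ weight β +ℤ + m *ℤ weight β ≡⟨ sym (ℤP.*-distribʳ-+ (weight β) 1ℤ (+ m)) ⟩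
  + suc m *ℤ weight β               ∎
  where open ≡-Reasoning

∣weight∣≤length : ∀ u → ∣ weight u ∣ ≤ length u
∣weight∣≤length []          = z≤n
∣weight∣≤length (true ∷ u)  = ℕP.≤-trans (ℤP.∣i+j∣≤∣i∣+∣j∣ 1ℤ (weight u)) (s≤s (∣weight∣≤length u))
∣weight∣≤length (false ∷ u) = ℕP.≤-trans (ℤP.∣i+j∣≤∣i∣+∣j∣ -1ℤ (weight u)) (s≤s (∣weight∣≤length u))

weight≡count⊖count : ∀ u → weight u ≡ count true u ⊖ count false u
weight≡count⊖count []          = refl
weight≡count⊖count (true ∷ u)  = begin
  1ℤ +ℤ weight u                               ≡⟨ cong (1ℤ +ℤ_) (weight≡count⊖count u) ⟩
  1ℤ +ℤ (count true u ⊖ count false u)         ≡⟨ cong (1ℤ +ℤ_) (sym (ℤP.m-n≡m⊖n (count true u) (count false u))) ⟩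
  1ℤ +ℤ (+ count true u +ℤ -ℤ + count false u) ≡⟨ sym (ℤP.+-assoc 1ℤ (+ count true u) (-ℤ + count false u)) ⟩
  + suc (count true u) +ℤ -ℤ + count false u   ≡⟨ ℤP.m-n≡m⊖n (suc (count true u)) (count false u) ⟩
  suc (count true u) ⊖ count false u           ∎
  where open ≡-Reasoning
weight≡count⊖count (false ∷ u) = begin
  -1ℤ +ℤ weight u                               ≡⟨ cong (-1ℤ +ℤ_) (weight≡count⊖count u) ⟩
  -1ℤ +ℤ (count true u ⊖ count false u)         ≡⟨ cong (-1ℤ +ℤ_) (sym (ℤP.m-n≡m⊖n (count true u) (count false u))) ⟩
  -1ℤ +ℤ (+ count true u +ℤ -ℤ + count false u) ≡⟨ shift-neg (+ count true u) (+ count false u) ⟩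
  + count true u +ℤ -ℤ + suc (count false u)    ≡⟨ ℤP.m-n≡m⊖n (count true u) (suc (count false u)) ⟩
  count true u ⊖ suc (count false u)            ∎
  where
  open ≡-Reasoning
  shift-neg : ∀ (a b : ℤ) → -1ℤ +ℤ (a +ℤ -ℤ b) ≡ a +ℤ -ℤ (1ℤ +ℤ b)
  shift-neg = solve-∀

∸⊔∸≡∣⊖∣ : ∀ a b → (a ∸ b) ⊔ (b ∸ a) ≡ ∣ a ⊖ b ∣
∸⊔∸≡∣⊖∣ a b with ℕP.≤-total b a
... | inj₁ b≤a rewrite ℤP.⊖-≥ b≤a | ℕP.m≤n⇒m∸n≡0 b≤a = ℕP.⊔-identityʳ (a ∸ b)
... | inj₂ a≤b rewrite ℤP.⊖-≤ a≤b | ℕP.m≤n⇒m∸n≡0 a≤b = sym (ℤP.∣-i∣≡∣i∣ (+ (b ∸ a)))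

imbalance≡∣weight∣ : ∀ u → imbalance u ≡ ∣ weight u ∣
imbalance≡∣weight∣ u =
  trans (∸⊔∸≡∣⊖∣ (count true u) (count false u)) (cong ∣_∣ (sym (weight≡count⊖count u)))

take-++-cases : ∀ k (u v : Str) →
  take k (u ++ v) ≡ take k u ⊎ ∃ λ j → take k (u ++ v) ≡ u ++ take j v
take-++-cases k       []      v = inj₂ (k , refl)
take-++-cases zero    (x ∷ u) v = inj₁ refl
take-++-cases (suc k) (x ∷ u) v with take-++-cases k u v
... | inj₁ eq       = inj₁ (cong (x ∷_) eq)
... | inj₂ (j , eq) = inj₂ (j , cong (x ∷_) eq)

take-+ : ∀ i k (x : Str) → take (i ℕ.+ k) x ≡ take i x ++ take k (drop i x)
take-+ zero    k x       = refl
take-+ (suc i) k []      = sym (ListP.take-[] k)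
take-+ (suc i) k (a ∷ x) = cong (a ∷_) (take-+ i k x)

PrefixBounded : ℕ → Str → Set
PrefixBounded n w = ∀ k → ∣ weight (take k w) ∣ ≤ n

Balanced : ℕ → Str → Set
Balanced n w = weight w ≡ 0ℤ × PrefixBounded n w

balanced-[] : ∀ n → Balanced n []
balanced-[] n = refl , λ k → subst (λ z → ∣ weight z ∣ ≤ n) (sym (ListP.take-[] k)) z≤n

-- Since u has weight 0, prefixes of u ++ v reaching into v have the weight of
-- the corresponding prefix of v.
balanced-++ : ∀ {n} u v → Balanced n u → Balanced n v → Balanced n (u ++ v)
balanced-++ {n} u v (u₀ , u-bounded) (v₀ , v-bounded) =
  trans (weight-++ u v) (cong₂ _+ℤ_ u₀ v₀) , bounded
  where
  bounded : PrefixBounded n (u ++ v)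
  bounded k with take-++-cases k u v
  ... | inj₁ eq rewrite eq = u-bounded k
  ... | inj₂ (j , eq) rewrite eq | weight-++ u (take j v) | u₀ | ℤP.+-identityˡ (weight (take j v)) =
    v-bounded j

∣weight∣≤ : ∀ {n} u → length u ≤ n → ∣ weight u ∣ ≤ n
∣weight∣≤ u |u|≤n = ℕP.≤-trans (∣weight∣≤length u) |u|≤n

balanced-block : ∀ α → Balanced (length α) (α ++ compl α)
balanced-block α = total , bounded
  where
  total : weight (α ++ compl α) ≡ 0ℤ
  total rewrite weight-++ α (compl α) | weight-compl α = ℤP.+-inverseʳ (weight α)
  cancel : ∀ (a b : ℤ) → a +ℤ b +ℤ -ℤ a ≡ b
  cancel = solve-∀
  weight-overlap : ∀ j → weight (α ++ take j (compl α)) ≡ weight (drop j α)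
  weight-overlap j = begin
    weight (α ++ take j (map not α))                               ≡⟨ weight-++ α _ ⟩
    weight α +ℤ weight (take j (map not α))                        ≡⟨ cong (λ z → weight α +ℤ weight z) (ListP.take-map j α) ⟩
    weight α +ℤ weight (compl (take j α))                          ≡⟨ cong (weight α +ℤ_) (weight-compl (take j α)) ⟩
    weight α +ℤ -ℤ weight (take j α)                               ≡⟨ cong (λ z → weight z +ℤ -ℤ weight (take j α)) (sym (ListP.take++drop≡id j α)) ⟩
    weight (take j α ++ drop j α) +ℤ -ℤ weight (take j α)          ≡⟨ cong (_+ℤ -ℤ weight (take j α)) (weight-++ (take j α) (drop j α)) ⟩
    weight (take j α) +ℤ weight (drop j α) +ℤ -ℤ weight (take j α) ≡⟨ cancel (weight (take j α)) (weight (drop j α)) ⟩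
    weight (drop j α)                                              ∎
    where open ≡-Reasoning
  bounded : PrefixBounded (length α) (α ++ compl α)
  bounded k with take-++-cases k α (compl α)
  ... | inj₁ eq rewrite eq =
    ∣weight∣≤ (take k α) (ℕP.≤-trans (ℕP.≤-reflexive (ListP.length-take k α)) (ℕP.m⊓n≤n k (length α)))
  ... | inj₂ (j , eq) rewrite eq | weight-overlap j =
    ∣weight∣≤ (drop j α) (ℕP.≤-trans (ℕP.≤-reflexive (ListP.length-drop j α)) (ℕP.m∸n≤m (length α) j))

-- A root β of a balanced string w = β^m is balanced: it is a prefix of w, and
-- m · weight β = 0 with m ≠ 0 (m = 0 forces w = [] and β = []).
balanced-root : ∀ {n} w p m → Balanced n w → power m (take p w) ≡ w → Balanced n (take p w)
balanced-root {n} w p zero    _ eq rewrite sym eq | ListP.take-[] {A = Bool} p = balanced-[] n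
balanced-root {n} w p (suc m) (w₀ , w-bounded) eq = total , bounded
  where
  total : weight (take p w) ≡ 0ℤ
  total with ℤP.i*j≡0⇒i≡0∨j≡0 (+ suc m)
               (trans (sym (weight-power (suc m) (take p w))) (trans (cong weight eq) w₀))
  ... | inj₂ β₀ = β₀
  bounded : PrefixBounded n (take p w)
  bounded k rewrite ListP.take-take k p w = w-bounded (k ⊓ p)

balanced-firstPeriod : ∀ {n} w → Balanced n w → ∀ ps → Balanced n (firstPeriod w ps)
balanced-firstPeriod w bal []           = bal
balanced-firstPeriod w bal (zero ∷ ps)  = balanced-firstPeriod w bal ps
balanced-firstPeriod w bal (suc q ∷ ps)
  with ListP.≡-dec Bool._≟_ (power (length w ℕ./ suc q) (take (suc q) w)) w
... | yes eq = balanced-root w (suc q) (length w ℕ./ suc q) bal eq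
... | no _   = balanced-firstPeriod w bal ps

balanced-pr : ∀ {n} w → Balanced n w → Balanced n (pr w)
balanced-pr w bal = balanced-firstPeriod w bal (applyUpTo suc (length w))

balanced-construct : ∀ n (L : List Str) → (∀ α → α ∈ L → length α ≡ n) → Balanced n (construct L)
balanced-construct n []      lengths = balanced-[] n
balanced-construct n (α ∷ L) lengths =
  balanced-++ (pr (α ++ compl α)) (construct L)
    (balanced-pr (α ++ compl α) (subst (λ m → Balanced m (α ++ compl α)) (lengths α (here refl)) (balanced-block α)))
    (balanced-construct n L (λ β β∈L → lengths β (there β∈L)))

factor-bound : ∀ {n} x i k → PrefixBounded n x → ∣ weight (take k (drop i x)) ∣ ≤ n ℕ.+ n
factor-bound {n} x i k x-bounded = subst (λ z → ∣ z ∣ ≤ n ℕ.+ n) (sym factor≡difference)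
  (ℕP.≤-trans (ℤP.∣i-j∣≤∣i∣+∣j∣ (weight (take (i ℕ.+ k) x)) (weight (take i x)))
              (ℕP.+-mono-≤ (x-bounded (i ℕ.+ k)) (x-bounded i)))
  where
  difference : ∀ (a b : ℤ) → b ≡ a +ℤ b +ℤ -ℤ a
  difference = solve-∀
  factor≡difference : weight (take k (drop i x)) ≡ weight (take (i ℕ.+ k) x) +ℤ -ℤ weight (take i x)
  factor≡difference rewrite take-+ i k x | weight-++ (take i x) (take k (drop i x)) =
    difference (weight (take i x)) (weight (take k (drop i x)))

maximum≤ : ∀ {B} (us : List Str) → All (λ u → imbalance u ≤ B) us → foldr _⊔_ 0 (map imbalance us) ≤ B
maximum≤ []       []       = z≤n
maximum≤ (u ∷ us) (p ∷ ps) = ℕP.⊔-lub p (maximum≤ us ps)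

-- Circular substrings of w are factors of w ++ w, which is balanced with w.
disc-balanced : ∀ n w → Balanced n w → disc w ≤ 2 * n
disc-balanced n w bal = subst (disc w ≤_) (cong (n ℕ.+_) (sym (ℕP.+-identityʳ n)))
  (maximum≤ (csub w)
    (AllP.concat⁺ (AllP.map⁺ (AllP.applyUpTo⁺₂ (λ i → i) (length w) (λ i →
      AllP.applyUpTo⁺₂ (λ k → take k (drop i (w ++ w))) (suc (length w)) (λ k →
        subst (_≤ n ℕ.+ n) (sym (imbalance≡∣weight∣ (take k (drop i (w ++ w)))))
          (factor-bound (w ++ w) i k (proj₂ (balanced-++ w w bal bal)))))))))

leadingZeros≤length : ∀ α → leadingZeros α ≤ length α
leadingZeros≤length []          = z≤n
leadingZeros≤length (false ∷ α) = s≤s (leadingZeros≤length α)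
leadingZeros≤length (true ∷ α)  = z≤n

length-shiftRep : ∀ α → length (shiftRep α) ≡ length α
length-shiftRep α = begin
  length (drop j α ++ replicate j true)           ≡⟨ ListP.length-++ (drop j α) ⟩
  length (drop j α) ℕ.+ length (replicate j true) ≡⟨ cong₂ ℕ._+_ (ListP.length-drop j α) (ListP.length-replicate j) ⟩
  length α ∸ j ℕ.+ j                              ≡⟨ ℕP.m∸n+n≡m (leadingZeros≤length α) ⟩
  length α                                        ∎
  where
  open ≡-Reasoning
  j = leadingZeros α

length-CCR3Rep : ∀ {n} β → IsCCR3Rep n β → length β ≡ n
length-CCR3Rep β (α , (|α|≡n , _) , β≡shift) rewrite β≡shift = trans (length-shiftRep α) |α|≡n

-- Both constructions concatenate reductions of blocks of length-n
-- representatives; the bound holds even without the hypothesis 1 ≤ n.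
theorem1 : (n : ℕ) → 1 ≤ n →
    ((L : List Str) → IsCCR2List n L → disc (construct L) ≤ 2 * n) ×
    ((L : List Str) → IsCCR3List n L → disc (construct L) ≤ 2 * n)
theorem1 n _ =
  (λ L (_ , members) → disc-balanced n _ (balanced-construct n L
     (λ α α∈L → proj₁ (proj₁ (members α) α∈L)))) ,
  (λ L (_ , members) → disc-balanced n _ (balanced-construct n L
     (λ β β∈L → length-CCR3Rep β (proj₁ (members β) β∈L))))
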